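{- Let $A,B,C$ be finite sets and let $\omega\colon I\to A\otimes B\otimes C$ be a state of $\mathsf{Stoch}$ (i.e. a probability distribution $\omega^{ijk}$ on $A\times B\times C$) with full support, i.e. $\omega^{ijk}>0$ for all $i\in A,j\in B,k\in C$. Then there exist a unique 2-comb $f\colon B\to A\otimes C$ and a unique stochastic matrix $g\colon A\to B$ such that, in $\mathsf{Mat}(\mathbb R^{+})$, $\omega$ equals the composite obtained by copying the $A$-output of $f$, feeding one copy into $g$, copying the output of $g$, and plugging one copy of $g$'s output into the $B$-input of $f$ (via a cup/cap), the remaining copies of the $A$ and $B$ wires and the $C$-output of $f$ being the outputs. In terms of matrix entries this equation reads $$\omega^{ijk}=f_j^{ik}\,g_i^j\qquad\text{for all } i\in A,\ j\in B,\ k\in C.$$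
   Context: $\mathsf{Stoch}$ is the symmetric monoidal category whose objects are finite sets and whose morphisms $h\colon X\to Y$ are $|Y|\times|X|$ matrices $h_x^y$ of nonnegative reals with $\sum_y h_x^y=1$ for each $x$ (stochastic matrices); composition is matrix multiplication, the monoidal product is the cartesian product of sets and Kronecker product of matrices, with unit $I=\{*\}$. A state is a morphism $I\to X$, i.e. a probability distribution on $X$. The discard map $X\to I$ is the row vector of all $1$'s, and the copy map $X\to X\otimes X$ is $\delta_x^{y}\delta_x^{z}$. $\mathsf{Mat}(\mathbb R^{+})$ is the (self-dual compact closed) symmetric monoidal category of all matrices with nonnegative real entries between finite sets, containing $\mathsf{Stoch}$ as a subcategory; its cups and caps are given by Kronecker deltas. A 2-comb in $\mathsf{Stoch}$ is a morphism $f\colon A_1\otimes A_2\to B_1\otimes B_2$ of $\mathsf{Stoch}$ such that, for some morphism $f'\colon A_1\to B_1$ of $\mathsf{Stoch}$, discarding the output $B_2$ of $f$ equals $f'\otimes(\text{discard on }A_2)$. Here $f\colon B\to A\otimes C$ is viewed as a 2-comb with $A_1=I$, $A_2=B$, $B_1=A$, $B_2=C$; concretely this means $f$ is a stochastic matrix with $\sum_{k\in C} f_j^{ik}$ independent of $j\in B$ for every $i\in A$. -}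

module Defs where

open import Level using (Level; _⊔_) renaming (suc to lsuc)
open import Data.Nat using (ℕ)
import Data.Nat as ℕ
open import Data.Fin using (Fin)
import Data.Fin as F
open import Data.Product using (Σ; _×_; _,_)
open import Relation.Nullary using (¬_)
open import Relation.Binary.Structures using (IsTotalOrder)
open import Algebra.Bundles using (CommutativeRing)

-- An ordered field (the paper works over ℝ, which is an instance).
record OrderedField (c ℓ₁ ℓ₂ : Level) : Set (lsuc (c ⊔ ℓ₁ ⊔ ℓ₂)) where
  field
    commutativeRing : CommutativeRing c ℓ₁
  open CommutativeRing commutativeRing public
  field
    _≤_          : Carrier → Carrier → Set ℓ₂
    isTotalOrder : IsTotalOrder _≈_ _≤_
    +-monoˡ-≤    : ∀ {x y} z → x ≤ y → (x + z) ≤ (y + z)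
    *-nonneg     : ∀ {x y} → 0# ≤ x → 0# ≤ y → 0# ≤ (x * y)
    0≉1          : ¬ (0# ≈ 1#)
    inverse      : ∀ x → ¬ (x ≈ 0#) → Σ Carrier (λ y → (x * y) ≈ 1#)

  _<_ : Carrier → Carrier → Set (ℓ₁ ⊔ ℓ₂)
  x < y = (x ≤ y) × ¬ (x ≈ y)

-- Finite stochastic linear algebra over an ordered field F.
-- Finite sets are Fin n.  A matrix h : X → Y is written as a function
-- h x y = h_x^y (column index = input x, row index = output y).
module Stoch {c ℓ₁ ℓ₂ : Level} (F : OrderedField c ℓ₁ ℓ₂) where
  open OrderedField F

  sum : ∀ {n} → (Fin n → Carrier) → Carrier
  sum {ℕ.zero}  f = 0#
  sum {ℕ.suc n} f = f F.zero + sum (λ i → f (F.suc i))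

  IsStochastic : ∀ {x y} → (Fin x → Fin y → Carrier) → Set (ℓ₁ ⊔ ℓ₂)
  IsStochastic h = (∀ i j → 0# ≤ h i j) × (∀ i → sum (h i) ≈ 1#)

  IsState : ∀ {x} → (Fin x → Carrier) → Set (ℓ₁ ⊔ ℓ₂)
  IsState p = (∀ i → 0# ≤ p i) × (sum p ≈ 1#)

  IsState3 : ∀ {a b c'} → (Fin a → Fin b → Fin c' → Carrier) → Set (ℓ₁ ⊔ ℓ₂)
  IsState3 ω = (∀ i j k → 0# ≤ ω i j k)
             × (sum (λ i → sum (λ j → sum (λ k → ω i j k))) ≈ 1#)

  FullSupport : ∀ {a b c'} → (Fin a → Fin b → Fin c' → Carrier) → Set (ℓ₁ ⊔ ℓ₂)
  FullSupport ω = ∀ i j k → 0# < ω i j k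

  -- stochastic matrix B → A ⊗ C, entries f j i k = f_j^{ik}
  IsStochastic2 : ∀ {a b c'} → (Fin b → Fin a → Fin c' → Carrier) → Set (ℓ₁ ⊔ ℓ₂)
  IsStochastic2 f = (∀ j i k → 0# ≤ f j i k)
                  × (∀ j → sum (λ i → sum (λ k → f j i k)) ≈ 1#)

  -- 2-comb f : B → A ⊗ C (A₁ = I, A₂ = B, B₁ = A, B₂ = C):
  -- f is stochastic and discarding C gives f' ⊗ discard_B for some state f' : I → A.
  IsTwoComb : ∀ {a b c'} → (Fin b → Fin a → Fin c' → Carrier) → Set (c ⊔ ℓ₁ ⊔ ℓ₂)
  IsTwoComb {a} f = IsStochastic2 f
    × Σ (Fin a → Carrier) (λ f' → IsState f' × (∀ j i → sum (λ k → f j i k) ≈ f' i))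

  Decomposes : ∀ {a b c'} → (Fin a → Fin b → Fin c' → Carrier)
             → (Fin b → Fin a → Fin c' → Carrier) → (Fin a → Fin b → Carrier) → Set ℓ₁
  Decomposes ω f g = ∀ i j k → ω i j k ≈ (f j i k * g i j)

module Submission where

open import Defs
open import Level using (Level)
open import Data.Nat using (ℕ; zero; suc)
open import Data.Fin as Fin using (Fin)
open import Data.Product using (Σ; _×_; _,_; proj₁; proj₂)
open import Data.Sum using (inj₁; inj₂)
open import Data.Empty using (⊥-elim)
open import Relation.Nullary using (¬_)
open import Relation.Binary.Structures using (IsTotalOrder)
import Algebra.Properties.CommutativeSemigroup as CommutativeSemigroupProperties
import Algebra.Properties.Ring as RingProperties
import Algebra.Properties.AbelianGroup as AbelianGroupProperties
import Relation.Binary.Reasoning.Setoid as SetoidReasoning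

-- With t_ij = Σ_k ω^{ijk} and s_i = Σ_j t_ij the marginals of ω, summing
-- ω^{ijk} = f_j^{ik} g_i^j over k (where the comb condition makes Σ_k f_j^{ik} = f'_i
-- independent of j) gives t_ij = f'_i g_i^j, and then summing over j gives s_i = f'_i.
-- Hence g_i^j = t_ij / s_i and f_j^{ik} = ω^{ijk} s_i / t_ij are forced, and full
-- support makes these quotients defined and shows that they form a decomposition.

module OrderedFieldProperties {c ℓ₁ ℓ₂ : Level} (F : OrderedField c ℓ₁ ℓ₂) where
  open OrderedField F
  open IsTotalOrder isTotalOrder using (total; antisym) renaming (trans to ≤-trans)
  open IsTotalOrder isTotalOrder public using (≤-respˡ-≈; ≤-respʳ-≈)
  open CommutativeSemigroupProperties *-commutativeSemigroup using (interchange)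
  open RingProperties ring using (-‿distribˡ-*; -‿distribʳ-*)
  open AbelianGroupProperties +-abelianGroup using (⁻¹-involutive)
  open SetoidReasoning setoid

  +-nonneg : ∀ {x y} → 0# ≤ x → 0# ≤ y → 0# ≤ (x + y)
  +-nonneg {x} {y} 0≤x 0≤y =
    ≤-trans 0≤y (≤-respˡ-≈ (+-identityˡ y) (+-monoˡ-≤ y 0≤x))

  +-pos : ∀ {x y} → 0# < x → 0# ≤ y → 0# < (x + y)
  +-pos {x} {y} (0≤x , 0≉x) 0≤y = +-nonneg 0≤x 0≤y , λ 0≈x+y →
    0≉x (antisym 0≤x (≤-respʳ-≈ (trans (+-comm y x) (sym 0≈x+y))
                                (≤-respˡ-≈ (+-identityˡ x) (+-monoˡ-≤ x 0≤y))))

  <⇒≉0 : ∀ {x} → 0# < x → ¬ (x ≈ 0#)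
  <⇒≉0 (_ , 0≉x) x≈0 = 0≉x (sym x≈0)

  ≤0⇒0≤- : ∀ {x} → x ≤ 0# → 0# ≤ (- x)
  ≤0⇒0≤- {x} x≤0 = ≤-respʳ-≈ (+-identityˡ (- x)) (≤-respˡ-≈ (-‿inverseʳ x) (+-monoˡ-≤ (- x) x≤0))

  -x*-x≈x*x : ∀ x → ((- x) * (- x)) ≈ (x * x)
  -x*-x≈x*x x = begin
    (- x) * (- x) ≈⟨ -‿distribˡ-* x (- x) ⟨
    - (x * (- x)) ≈⟨ -‿cong (-‿distribʳ-* x x) ⟨
    - (- (x * x)) ≈⟨ ⁻¹-involutive (x * x) ⟩
    x * x         ∎

  x*x-nonneg : ∀ x → 0# ≤ (x * x)
  x*x-nonneg x with total 0# x
  ... | inj₁ 0≤x = *-nonneg 0≤x 0≤x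
  ... | inj₂ x≤0 = ≤-respʳ-≈ (-x*-x≈x*x x) (*-nonneg (≤0⇒0≤- x≤0) (≤0⇒0≤- x≤0))

  -- y = s y², so y inherits the sign of s.
  inverse-nonneg : ∀ {s y} → 0# ≤ s → (s * y) ≈ 1# → 0# ≤ y
  inverse-nonneg {s} {y} 0≤s s*y≈1 = ≤-respʳ-≈ s*y*y≈y (*-nonneg 0≤s (x*x-nonneg y))
    where
    s*y*y≈y : (s * (y * y)) ≈ y
    s*y*y≈y = begin
      s * (y * y) ≈⟨ *-assoc s y y ⟨
      (s * y) * y ≈⟨ *-congʳ s*y≈1 ⟩
      1# * y      ≈⟨ *-identityˡ y ⟩
      y           ∎

  *-cancelʳ-inverse : ∀ {x y s s'} → (s * s') ≈ 1# → x ≈ (y * s) → y ≈ (x * s')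
  *-cancelʳ-inverse {x} {y} {s} {s'} s*s'≈1 x≈y*s = sym (begin
    x * s'       ≈⟨ *-congʳ x≈y*s ⟩
    (y * s) * s' ≈⟨ *-assoc y s s' ⟩
    y * (s * s') ≈⟨ *-congˡ s*s'≈1 ⟩
    y * 1#       ≈⟨ *-identityʳ y ⟩
    y            ∎)

  ratio-inverse : ∀ {t t' s s'} → (t * t') ≈ 1# → (s * s') ≈ 1# → ((t * s') * (t' * s)) ≈ 1#
  ratio-inverse {t} {t'} {s} {s'} t*t'≈1 s*s'≈1 = begin
    (t * s') * (t' * s) ≈⟨ interchange t s' t' s ⟩
    (t * t') * (s' * s) ≈⟨ *-cong t*t'≈1 (trans (*-comm s' s) s*s'≈1) ⟩
    1# * 1#             ≈⟨ *-identityˡ 1# ⟩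
    1#                  ∎

  module _ {x : Carrier} (0<x : 0# < x) where

    _⁻¹ : Carrier
    _⁻¹ = proj₁ (inverse x (<⇒≉0 0<x))

    *-inverseʳ : (x * _⁻¹) ≈ 1#
    *-inverseʳ = proj₂ (inverse x (<⇒≉0 0<x))

    ⁻¹-nonneg : 0# ≤ _⁻¹
    ⁻¹-nonneg = inverse-nonneg (proj₁ 0<x) *-inverseʳ

module SumProperties {c ℓ₁ ℓ₂ : Level} (F : OrderedField c ℓ₁ ℓ₂) where
  open OrderedField F
  open Stoch F
  open OrderedFieldProperties F using (+-nonneg; +-pos)

  sum-cong : ∀ {n} {f g : Fin n → Carrier} → (∀ i → f i ≈ g i) → sum f ≈ sum g
  sum-cong {zero}  f≈g = refl
  sum-cong {suc n} f≈g = +-cong (f≈g Fin.zero) (sum-cong (λ i → f≈g (Fin.suc i)))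

  sum≈0 : ∀ {n} {f : Fin n → Carrier} → (∀ i → f i ≈ 0#) → sum f ≈ 0#
  sum≈0 {zero}  f≈0 = refl
  sum≈0 {suc n} f≈0 = trans (+-cong (f≈0 Fin.zero) (sum≈0 (λ i → f≈0 (Fin.suc i)))) (+-identityˡ 0#)

  *-distribʳ-sum : ∀ {n} (f : Fin n → Carrier) x → sum (λ i → f i * x) ≈ (sum f * x)
  *-distribʳ-sum {zero}  f x = sym (zeroˡ x)
  *-distribʳ-sum {suc n} f x =
    trans (+-congˡ (*-distribʳ-sum (λ i → f (Fin.suc i)) x)) (sym (distribʳ x (f Fin.zero) _))

  *-distribˡ-sum : ∀ {n} (f : Fin n → Carrier) x → sum (λ i → x * f i) ≈ (x * sum f)
  *-distribˡ-sum f x =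
    trans (sum-cong (λ i → *-comm x (f i))) (trans (*-distribʳ-sum f x) (*-comm (sum f) x))

  sum-zeros≉1 : ∀ {n} (f : Fin n → Carrier) → (∀ i → f i ≈ 0#) → ¬ (sum f ≈ 1#)
  sum-zeros≉1 f f≈0 sum≈1 = 0≉1 (trans (sym (sum≈0 f≈0)) sum≈1)

  sum-nonneg : ∀ {n} {f : Fin n → Carrier} → (∀ i → 0# ≤ f i) → 0# ≤ sum f
  sum-nonneg {zero}  0≤f = IsTotalOrder.refl isTotalOrder
  sum-nonneg {suc n} 0≤f = +-nonneg (0≤f Fin.zero) (sum-nonneg (λ i → 0≤f (Fin.suc i)))

  sum-pos : ∀ {n} {f : Fin (suc n) → Carrier} → (∀ i → 0# < f i) → 0# < sum f
  sum-pos 0<f = +-pos (0<f Fin.zero) (sum-nonneg (λ i → proj₁ (0<f (Fin.suc i))))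

module Disintegration {c ℓ₁ ℓ₂ : Level} (F : OrderedField c ℓ₁ ℓ₂)
                      {a b c' : ℕ} (ω : Fin a → Fin b → Fin c' → OrderedField.Carrier F) where
  open OrderedField F
  open Stoch F
  open SumProperties F
  open SetoidReasoning setoid

  marginalAB : Fin a → Fin b → Carrier
  marginalAB i j = sum (ω i j)

  marginalA : Fin a → Carrier
  marginalA i = sum (marginalAB i)

  module _ {f : Fin b → Fin a → Fin c' → Carrier} {g : Fin a → Fin b → Carrier}
           {f' : Fin a → Carrier} (f-marginal : ∀ j i → sum (f j i) ≈ f' i)
           (g-stochastic : IsStochastic g) (decomposes : Decomposes ω f g) where

    marginalAB≈ : ∀ i j → marginalAB i j ≈ (f' i * g i j)
    marginalAB≈ i j = begin
      sum (ω i j)                   ≈⟨ sum-cong (decomposes i j) ⟩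
      sum (λ k → f j i k * g i j)   ≈⟨ *-distribʳ-sum (f j i) (g i j) ⟩
      sum (f j i) * g i j           ≈⟨ *-congʳ (f-marginal j i) ⟩
      f' i * g i j                  ∎

    marginalA≈ : ∀ i → marginalA i ≈ f' i
    marginalA≈ i = begin
      sum (marginalAB i)            ≈⟨ sum-cong (marginalAB≈ i) ⟩
      sum (λ j → f' i * g i j)      ≈⟨ *-distribˡ-sum (g i) (f' i) ⟩
      f' i * sum (g i)              ≈⟨ *-congˡ (proj₂ g-stochastic i) ⟩
      f' i * 1#                     ≈⟨ *-identityʳ (f' i) ⟩
      f' i                          ∎

    marginalAB≈*marginalA : ∀ i j → marginalAB i j ≈ (g i j * marginalA i)
    marginalAB≈*marginalA i j =
      trans (marginalAB≈ i j) (trans (*-comm (f' i) (g i j)) (*-congˡ (sym (marginalA≈ i))))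

module FullSupportDisintegration {c ℓ₁ ℓ₂ : Level} (F : OrderedField c ℓ₁ ℓ₂)
    {a b c' : ℕ} (ω : Fin a → Fin (suc b) → Fin (suc c') → OrderedField.Carrier F)
    (state : Stoch.IsState3 F ω) (full : Stoch.FullSupport F ω) where
  open OrderedField F
  open Stoch F
  open SumProperties F
  open OrderedFieldProperties F
  open Disintegration F ω
  open SetoidReasoning setoid

  marginalAB-pos : ∀ i j → 0# < marginalAB i j
  marginalAB-pos i j = sum-pos (full i j)

  marginalA-pos : ∀ i → 0# < marginalA i
  marginalA-pos i = sum-pos (marginalAB-pos i)

  channel : Fin a → Fin (suc b) → Carrier
  channel i j = marginalAB i j * (marginalA-pos i ⁻¹)

  channel⁻¹ : Fin a → Fin (suc b) → Carrier
  channel⁻¹ i j = (marginalAB-pos i j ⁻¹) * marginalA i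

  comb : Fin (suc b) → Fin a → Fin (suc c') → Carrier
  comb j i k = ω i j k * channel⁻¹ i j

  channel*channel⁻¹ : ∀ i j → (channel i j * channel⁻¹ i j) ≈ 1#
  channel*channel⁻¹ i j = ratio-inverse (*-inverseʳ (marginalAB-pos i j)) (*-inverseʳ (marginalA-pos i))

  channel-isStochastic : IsStochastic channel
  channel-isStochastic =
      (λ i j → *-nonneg (proj₁ (marginalAB-pos i j)) (⁻¹-nonneg (marginalA-pos i)))
    , (λ i → trans (*-distribʳ-sum (marginalAB i) _) (*-inverseʳ (marginalA-pos i)))

  comb-marginal : ∀ j i → sum (comb j i) ≈ marginalA i
  comb-marginal j i = begin
    sum (comb j i)                                                 ≈⟨ *-distribʳ-sum (ω i j) (channel⁻¹ i j) ⟩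
    marginalAB i j * ((marginalAB-pos i j ⁻¹) * marginalA i)       ≈⟨ *-assoc _ _ _ ⟨
    (marginalAB i j * (marginalAB-pos i j ⁻¹)) * marginalA i       ≈⟨ *-congʳ (*-inverseʳ (marginalAB-pos i j)) ⟩
    1# * marginalA i                                               ≈⟨ *-identityˡ (marginalA i) ⟩
    marginalA i                                                    ∎

  comb-isTwoComb : IsTwoComb comb
  comb-isTwoComb =
      ( (λ j i k → *-nonneg (proj₁ state i j k)
                            (*-nonneg (⁻¹-nonneg (marginalAB-pos i j)) (proj₁ (marginalA-pos i))))
      , (λ j → trans (sum-cong (comb-marginal j)) (proj₂ state)))
    , marginalA , ((λ i → proj₁ (marginalA-pos i)) , proj₂ state) , comb-marginal

  comb-channel-decomposes : Decomposes ω comb channel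
  comb-channel-decomposes i j k =
    *-cancelʳ-inverse (trans (*-comm _ _) (channel*channel⁻¹ i j)) refl

  module _ {f : Fin (suc b) → Fin a → Fin (suc c') → Carrier} {g : Fin a → Fin (suc b) → Carrier}
           (f-twoComb : IsTwoComb f) (g-stochastic : IsStochastic g) (decomposes : Decomposes ω f g) where

    private
      g-marginals : ∀ i j → marginalAB i j ≈ (g i j * marginalA i)
      g-marginals = marginalAB≈*marginalA (proj₂ (proj₂ (proj₂ f-twoComb))) g-stochastic decomposes

    channel-unique : ∀ i j → g i j ≈ channel i j
    channel-unique i j = *-cancelʳ-inverse (*-inverseʳ (marginalA-pos i)) (g-marginals i j)

    comb-unique : ∀ j i k → f j i k ≈ comb j i k
    comb-unique j i k = *-cancelʳ-inverse (channel*channel⁻¹ i j)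
                                          (trans (decomposes i j k) (*-congˡ (channel-unique i j)))

open SumProperties using (sum≈0; sum-zeros≉1)
open Disintegration using (marginalA; marginalAB)

theorem1 : ∀ {c ℓ₁ ℓ₂ : Level} (F : OrderedField c ℓ₁ ℓ₂) → let open OrderedField F in let open Stoch F in
    ∀ {a b c' : ℕ} (ω : Fin a → Fin b → Fin c' → Carrier) → IsState3 ω → FullSupport ω →
    Σ (Fin b → Fin a → Fin c' → Carrier) (λ f → Σ (Fin a → Fin b → Carrier) (λ g →
    (IsTwoComb f × IsStochastic g × Decomposes ω f g)
    × (∀ (f₂ : Fin b → Fin a → Fin c' → Carrier) (g₂ : Fin a → Fin b → Carrier) →
    IsTwoComb f₂ → IsStochastic g₂ → Decomposes ω f₂ g₂ →
    (∀ j i k → f₂ j i k ≈ f j i k) × (∀ i j → g₂ i j ≈ g i j))))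
theorem1 F {b = zero} ω (_ , total) _ = ⊥-elim (sum-zeros≉1 F (marginalA F ω) (λ _ → refl) total)
  where open OrderedField F using (refl)
theorem1 F {b = suc b} {zero} ω (_ , total) _ =
  ⊥-elim (sum-zeros≉1 F (marginalA F ω) (λ i → sum≈0 F {f = marginalAB F ω i} (λ _ → refl)) total)
  where open OrderedField F using (refl)
theorem1 F {b = suc b} {suc c'} ω state full =
    comb , channel , (comb-isTwoComb , channel-isStochastic , comb-channel-decomposes)
  , λ f g f-twoComb g-stochastic decomposes →
      comb-unique f-twoComb g-stochastic decomposes , channel-unique f-twoComb g-stochastic decomposes
  where open FullSupportDisintegration F ω state full
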